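{- Let $\Gamma\le S_m$ and let $a_1,\dots,a_m\ge2$ be integers. Let $O_1,\dots,O_k$ be the orbits of the action of the commutator subgroup $[\Gamma,\Gamma]$ on $[m]$, and for each $i$ let $n_i=\min\{a_j:j\in O_i\}$. Let $\Gamma'\le S_k$ be the permutation group on $\{1,\dots,k\}$ induced by the action of $\Gamma/[\Gamma,\Gamma]$ on the set of orbits ($\sigma\in\Gamma$ induces $i\mapsto i'$ where $\sigma(O_i)=O_{i'}$). Let $P_1,\dots,P_q$ be the orbits of $\Gamma'$ on $\{1,\dots,k\}$, with $P_j=\{c_{1,j},c_{2,j},\dots,c_{|P_j|,j}\}$, and let \[m_j=R_{\Gamma'|_{P_j}}(n_{c_{1,j}},n_{c_{2,j}},\dots,n_{c_{|P_j|,j}}),\] where $\Gamma'|_{P_j}$ is the group of permutations of $P_j$ obtained by restricting elements of $\Gamma'$ to $P_j$. Then \[R_\Gamma(a_1,a_2,\dots,a_m)\le R(m_1,m_2,\dots,m_q).\]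
   Context: An $m$-edge-coloured complete graph is a complete graph with each edge coloured from $[m]=\{1,\dots,m\}$. For a permutation group $\Delta$ on a finite colour set $C$, $\pi\in\Delta$ and a vertex $v$, switching at $v$ with $\pi$ recolours every edge incident with $v$ of colour $i$ to colour $\pi(i)$, leaving other edges unchanged. Two edge-coloured complete graphs on the same vertex set are $\Delta$-switch equivalent if one is obtained from the other by a finite sequence of switches. For colours $c_1,\dots,c_r$ forming $C$ and integers $b_1,\dots,b_r\ge2$, $R_\Delta(b_1,\dots,b_r)$ is the least $n$ such that every $C$-edge-coloured complete graph on $n$ vertices is $\Delta$-switch equivalent to one containing, for some $\ell$, a complete subgraph on $b_\ell$ vertices all of whose edges have colour $c_\ell$. $R(\cdot)$ is the classical multicolour Ramsey number. -}

module Defs where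

open import Level using (0ℓ)
open import Data.Nat using (ℕ; _≤_)
open import Data.Fin using (Fin)
open import Data.Product using (Σ; ∃; ∃-syntax; _×_; _,_; proj₁)
open import Data.Sum using (_⊎_)
open import Function.Bundles using (_↔_; Inverse)
open import Function.Properties.Inverse using (↔-refl; ↔-sym; ↔-trans)
open import Relation.Binary.PropositionalEquality using (_≡_; _≢_)
open import Relation.Nullary using (Dec; yes; no)
open import Relation.Binary using (DecidableEquality)

Perm : Set → Set
Perm C = C ↔ C

app : {C : Set} → Perm C → C → C
app π = Inverse.to π

-- composition: (π ∘ ρ) x = π (ρ x)
_∘ₚ_ : {C : Set} → Perm C → Perm C → Perm C
π ∘ₚ ρ = ↔-trans ρ π

_⁻¹ₚ : {C : Set} → Perm C → Perm C
π ⁻¹ₚ = ↔-sym π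

idₚ : {C : Set} → Perm C
idₚ = ↔-refl

record IsPermGroup {C : Set} (Γ : Perm C → Set) : Set₁ where
  field
    resp : ∀ {π ρ} → (∀ x → app π x ≡ app ρ x) → Γ π → Γ ρ
    has-id : Γ idₚ
    closed-∘ : ∀ {π ρ} → Γ π → Γ ρ → Γ (π ∘ₚ ρ)
    closed-⁻¹ : ∀ {π} → Γ π → Γ (π ⁻¹ₚ)

data Commutator {C : Set} (Γ : Perm C → Set) : Perm C → Set where
  comm : ∀ {σ τ} → Γ σ → Γ τ →
         Commutator Γ ((σ ⁻¹ₚ) ∘ₚ ((τ ⁻¹ₚ) ∘ₚ (σ ∘ₚ τ)))
  c-id : Commutator Γ idₚ
  c-∘ : ∀ {π ρ} → Commutator Γ π → Commutator Γ ρ → Commutator Γ (π ∘ₚ ρ)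
  c-⁻¹ : ∀ {π} → Commutator Γ π → Commutator Γ (π ⁻¹ₚ)
  c-resp : ∀ {π ρ} → (∀ x → app π x ≡ app ρ x) → Commutator Γ π → Commutator Γ ρ

SameOrbit : {C : Set} (Δ : Perm C → Set) → C → C → Set
SameOrbit Δ x y = ∃[ π ] (Δ π × app π x ≡ y)

-- lab : C → Fin k is a labelling of the orbits of Δ by 1..k:
-- surjective, and two points get the same label iff same orbit.
IsOrbitLabelling : {C : Set} (Δ : Perm C → Set) (k : ℕ) → (C → Fin k) → Set
IsOrbitLabelling {C} Δ k lab =
  (∀ (i : Fin k) → ∃[ x ] lab x ≡ i) ×
  (∀ (x y : C) → (lab x ≡ lab y → SameOrbit Δ x y) × (SameOrbit Δ x y → lab x ≡ lab y))

-- A C-edge-coloured complete graph on vertex set Fin n: a symmetric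
-- function; values on the diagonal are irrelevant.
Colouring : ℕ → Set → Set
Colouring n C = Fin n → Fin n → C

Symmetric : {n : ℕ} {C : Set} → Colouring n C → Set
Symmetric c = ∀ u w → c u w ≡ c w u

switch : {n : ℕ} {C : Set} → Fin n → (C → C) → Colouring n C → Colouring n C
switch {n} v π c x y with x Data.Fin.≟ v | y Data.Fin.≟ v
... | yes _ | _     = π (c x y)
... | no _  | yes _ = π (c x y)
... | no _  | no _  = c x y

data SwitchEq {n : ℕ} {C : Set} (Δ : Perm C → Set) : Colouring n C → Colouring n C → Set where
  done : ∀ {c} → SwitchEq Δ c c
  step : ∀ {c d} (v : Fin n) (π : Perm C) → Δ π →
         SwitchEq Δ (switch v (app π) c) d → SwitchEq Δ c d

HasMonoClique : {n : ℕ} {C : Set} → Colouring n C → ℕ → C → Set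
HasMonoClique {n} c b ℓ =
  Σ (Fin b → Fin n) λ f →
    (∀ s t → f s ≡ f t → s ≡ t) ×
    (∀ s t → s ≢ t → c (f s) (f t) ≡ ℓ)

SwitchArrow : {C : Set} → (Perm C → Set) → (C → ℕ) → ℕ → Set
SwitchArrow {C} Δ b n =
  ∀ (c : Colouring n C) → Symmetric c →
    ∃[ d ] (SwitchEq Δ c d × ∃[ ℓ ] HasMonoClique d (b ℓ) ℓ)

Arrow : {q : ℕ} → (Fin q → ℕ) → ℕ → Set
Arrow {q} b n =
  ∀ (c : Colouring n (Fin q)) → Symmetric c → ∃[ ℓ ] HasMonoClique c (b ℓ) ℓ

IsLeast : (ℕ → Set) → ℕ → Set
IsLeast P n = P n × (∀ r → P r → n ≤ r)

Induced : {m k : ℕ} → (Perm (Fin m) → Set) → (Fin m → Fin k) → Perm (Fin k) → Set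
Induced Γ orb τ = ∃[ σ ] (Γ σ × (∀ j → app τ (orb j) ≡ orb (app σ j)))

Part : {k q : ℕ} → (Fin k → Fin q) → Fin q → Set
Part porb j = Σ (Fin _) λ i → porb i ≡ j

Restrict : {k q : ℕ} (Γ' : Perm (Fin k) → Set) (porb : Fin k → Fin q) (j : Fin q) →
           Perm (Part porb j) → Set
Restrict Γ' porb j τ' = ∃[ τ ] (Γ' τ × (∀ x → proj₁ (app τ' x) ≡ app τ (proj₁ x)))

-- Switching at the two ends u, w of an edge with τ, σ, τ⁻¹, σ⁻¹ applies the commutator
-- σ⁻¹τ⁻¹στ to the edge uw and leaves every other edge unchanged, so edge colours can be moved
-- independently within their [Γ,Γ]-orbits. Colour each edge by the Γ'-orbit P_j of its
-- [Γ,Γ]-orbit: a classical Ramsey clique of size m_j inside P_j carries an induced colouring by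
-- P_j, which by the definition of m_j is Γ'|_{P_j}-switch equivalent to one with a clique of size
-- n_i in a single orbit O_i. Those switches lift to Γ-switches of the original colouring, and the
-- commutator moves then recolour that clique with a colour j ∈ O_i satisfying a_j = n_i.

module Submission where

open import Defs
open import Data.Nat using (ℕ; _≤_)
open import Data.Fin using (Fin; _≟_)
open import Data.Product using (∃-syntax; _×_; proj₁; proj₂; _,_)
open import Data.Product.Properties using (Σ-≡,≡→≡)
open import Data.Sum using (_⊎_; inj₁; inj₂; [_,_]; swap) renaming (map to ⊎-map)
open import Data.Empty using (⊥-elim)
open import Data.List using (List; []; _∷_; cartesianProduct; allFin)
open import Data.List.Membership.Propositional using (_∈_)
open import Data.List.Membership.Propositional.Properties using (∈-cartesianProduct⁺; ∈-allFin)
open import Data.List.Relation.Unary.Any using (here; there)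
open import Function using (_∘_; id)
open import Function.Bundles using (Inverse)
open import Relation.Binary.PropositionalEquality using (_≡_; _≢_; refl; sym; trans; cong; subst; module ≡-Reasoning)
open import Relation.Nullary using (¬_; Dec; yes; no)
open import Relation.Nullary.Decidable using (_⊎-dec_; _×-dec_)
open import Axiom.UniquenessOfIdentityProofs using (module Decidable⇒UIP)

module _ {n : ℕ} where

  Incident : Fin n → Fin n → Fin n → Set
  Incident v x y = x ≡ v ⊎ y ≡ v

  incident? : ∀ v x y → Dec (Incident v x y)
  incident? v x y = (x ≟ v) ⊎-dec (y ≟ v)

  incident-both : ∀ {u w x y} → u ≢ w → Incident u x y → Incident w x y →
                  (x ≡ u × y ≡ w) ⊎ (x ≡ w × y ≡ u)
  incident-both u≢w (inj₁ refl) (inj₁ refl) = ⊥-elim (u≢w refl)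
  incident-both u≢w (inj₁ refl) (inj₂ refl) = inj₁ (refl , refl)
  incident-both u≢w (inj₂ refl) (inj₁ refl) = inj₂ (refl , refl)
  incident-both u≢w (inj₂ refl) (inj₂ refl) = ⊥-elim (u≢w refl)

when : {P C : Set} → Dec P → (C → C) → C → C
when (yes _) f = f
when (no _)  _ = id

module _ {n : ℕ} {C : Set} where

  switch-when : ∀ (v : Fin n) p (c : Colouring n C) x y →
                switch v p c x y ≡ when (incident? v x y) p (c x y)
  switch-when v p c x y with x ≟ v | y ≟ v
  ... | yes _ | _     = refl
  ... | no _  | yes _ = refl
  ... | no _  | no _  = refl

  switch-symmetric : ∀ (v : Fin n) p (c : Colouring n C) → Symmetric c → Symmetric (switch v p c)
  switch-symmetric v p c c-sym x y
    rewrite switch-when v p c x y | switch-when v p c y x | c-sym x y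
    with incident? v x y | incident? v y x
  ... | yes _ | yes _ = refl
  ... | no _  | no _  = refl
  ... | yes i | no ¬i = ⊥-elim (¬i (swap i))
  ... | no ¬i | yes i = ⊥-elim (¬i (swap i))

  SwitchEq-symmetric : ∀ {Δ} {c d : Colouring n C} → SwitchEq Δ c d → Symmetric c → Symmetric d
  SwitchEq-symmetric done                c-sym = c-sym
  SwitchEq-symmetric {c = c} (step v π _ r) c-sym = SwitchEq-symmetric r (switch-symmetric v (app π) c c-sym)

  SwitchEq-trans : ∀ {Δ} {c d e : Colouring n C} → SwitchEq Δ c d → SwitchEq Δ d e → SwitchEq Δ c e
  SwitchEq-trans done           q = q
  SwitchEq-trans (step v π g r) q = step v π g (SwitchEq-trans r q)

inverse-cong : {C : Set} {π ρ : Perm C} → (∀ x → app π x ≡ app ρ x) → ∀ x → app (π ⁻¹ₚ) x ≡ app (ρ ⁻¹ₚ) x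
inverse-cong {π = π} {ρ} π≗ρ x = begin
  app (π ⁻¹ₚ) x                       ≡⟨ cong (app (π ⁻¹ₚ)) (sym (Inverse.strictlyInverseˡ ρ x)) ⟩
  app (π ⁻¹ₚ) (app ρ (app (ρ ⁻¹ₚ) x)) ≡⟨ cong (app (π ⁻¹ₚ)) (sym (π≗ρ _)) ⟩
  app (π ⁻¹ₚ) (app π (app (ρ ⁻¹ₚ) x)) ≡⟨ Inverse.strictlyInverseʳ π _ ⟩
  app (ρ ⁻¹ₚ) x                       ∎
  where open ≡-Reasoning

module CommutatorSwitching {C : Set} {Γ : Perm C → Set} (isGroup : IsPermGroup Γ) where
  open IsPermGroup isGroup

  AgreeOffEdge : {n : ℕ} → Fin n → Fin n → Colouring n C → Colouring n C → Set
  AgreeOffEdge u w c d = ∀ x y → ¬ (x ≡ u × y ≡ w) → ¬ (x ≡ w × y ≡ u) → d x y ≡ c x y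

  record EdgeRealisable (π : Perm C) : Set where
    field
      realise : ∀ {n} (c : Colouring n C) (u w : Fin n) → u ≢ w →
        ∃[ d ] (SwitchEq Γ c d × d u w ≡ app π (c u w) × d w u ≡ app π (c w u) × AgreeOffEdge u w c d)
  open EdgeRealisable

  realisable-cong : ∀ {π ρ} → (∀ x → app π x ≡ app ρ x) → EdgeRealisable π → EdgeRealisable ρ
  realisable-cong π≗ρ π! .realise c u w u≢w with π! .realise c u w u≢w
  ... | d , c∼d , uw , wu , off = d , c∼d , trans uw (π≗ρ _) , trans wu (π≗ρ _) , off

  realisable-id : EdgeRealisable idₚ
  realisable-id .realise c _ _ _ = c , done , refl , refl , λ _ _ _ _ → refl

  realisable-∘ : ∀ {π ρ} → EdgeRealisable π → EdgeRealisable ρ → EdgeRealisable (π ∘ₚ ρ)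
  realisable-∘ {π} π! ρ! .realise c u w u≢w with ρ! .realise c u w u≢w
  ... | d , c∼d , uw , wu , off with π! .realise d u w u≢w
  ... | e , d∼e , uw′ , wu′ , off′ =
    e , SwitchEq-trans c∼d d∼e , trans uw′ (cong (app π) uw) , trans wu′ (cong (app π) wu) ,
    λ x y ¬uw ¬wu → trans (off′ x y ¬uw ¬wu) (off x y ¬uw ¬wu)

  commutator-realisable : ∀ {σ τ} → Γ σ → Γ τ → EdgeRealisable ((σ ⁻¹ₚ) ∘ₚ ((τ ⁻¹ₚ) ∘ₚ (σ ∘ₚ τ)))
  commutator-realisable {σ} {τ} Γσ Γτ .realise c u w u≢w =
    c₄ , c∼c₄ , on-edge u w (inj₁ refl) (inj₂ refl) , on-edge w u (inj₂ refl) (inj₁ refl) , off-edge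
    where
    c₁ = switch u (app τ) c
    c₂ = switch w (app σ) c₁
    c₃ = switch u (app (τ ⁻¹ₚ)) c₂
    c₄ = switch w (app (σ ⁻¹ₚ)) c₃

    c∼c₄ : SwitchEq Γ c c₄
    c∼c₄ = step u τ Γτ (step w σ Γσ (step u (τ ⁻¹ₚ) (closed-⁻¹ Γτ) (step w (σ ⁻¹ₚ) (closed-⁻¹ Γσ) done)))

    c₄-when : ∀ x y → let at-u = when (incident? u x y); at-w = when (incident? w x y) in
              c₄ x y ≡ at-w (app (σ ⁻¹ₚ)) (at-u (app (τ ⁻¹ₚ)) (at-w (app σ) (at-u (app τ) (c x y))))
    c₄-when x y = begin
      c₄ x y                                                   ≡⟨ switch-when w _ c₃ x y ⟩
      at-w (app (σ ⁻¹ₚ)) (c₃ x y)                               ≡⟨ cong (at-w _) (switch-when u _ c₂ x y) ⟩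
      at-w (app (σ ⁻¹ₚ)) (at-u (app (τ ⁻¹ₚ)) (c₂ x y))          ≡⟨ cong (at-w _ ∘ at-u _) (switch-when w _ c₁ x y) ⟩
      at-w (app (σ ⁻¹ₚ)) (at-u (app (τ ⁻¹ₚ)) (at-w (app σ) (c₁ x y)))
        ≡⟨ cong (at-w _ ∘ at-u _ ∘ at-w _) (switch-when u _ c x y) ⟩
      at-w (app (σ ⁻¹ₚ)) (at-u (app (τ ⁻¹ₚ)) (at-w (app σ) (at-u (app τ) (c x y)))) ∎
      where
      open ≡-Reasoning
      at-u = when (incident? u x y)
      at-w = when (incident? w x y)

    on-edge : ∀ x y → Incident u x y → Incident w x y →
              c₄ x y ≡ app ((σ ⁻¹ₚ) ∘ₚ ((τ ⁻¹ₚ) ∘ₚ (σ ∘ₚ τ))) (c x y)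
    on-edge x y iu iw rewrite c₄-when x y with incident? u x y | incident? w x y
    ... | yes _  | yes _  = refl
    ... | no ¬iu | _      = ⊥-elim (¬iu iu)
    ... | _      | no ¬iw = ⊥-elim (¬iw iw)

    off-edge : AgreeOffEdge u w c c₄
    off-edge x y ¬uw ¬wu rewrite c₄-when x y with incident? u x y | incident? w x y
    ... | yes iu | yes iw = ⊥-elim ([ ¬uw , ¬wu ] (incident-both u≢w iu iw))
    ... | yes _  | no _   = Inverse.strictlyInverseʳ τ _
    ... | no _   | yes _  = Inverse.strictlyInverseʳ σ _
    ... | no _   | no _   = refl

  -- Realisability of π⁻¹ is carried along, as the generator c-⁻¹ requires it.
  commutatorSubgroup-realisable : ∀ {π} → Commutator Γ π → EdgeRealisable π × EdgeRealisable (π ⁻¹ₚ)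
  commutatorSubgroup-realisable (comm Γσ Γτ) =
    commutator-realisable Γσ Γτ , realisable-cong (λ _ → refl) (commutator-realisable Γτ Γσ)
  commutatorSubgroup-realisable c-id = realisable-id , realisable-cong (λ _ → refl) realisable-id
  commutatorSubgroup-realisable (c-∘ cπ cρ)
    with commutatorSubgroup-realisable cπ | commutatorSubgroup-realisable cρ
  ... | π! , π⁻¹! | ρ! , ρ⁻¹! = realisable-∘ π! ρ! , realisable-cong (λ _ → refl) (realisable-∘ ρ⁻¹! π⁻¹!)
  commutatorSubgroup-realisable (c-⁻¹ cπ) with commutatorSubgroup-realisable cπ
  ... | π! , π⁻¹! = π⁻¹! , realisable-cong (λ _ → refl) π!
  commutatorSubgroup-realisable (c-resp {π} {ρ} π≗ρ cπ) with commutatorSubgroup-realisable cπ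
  ... | π! , π⁻¹! = realisable-cong π≗ρ π! , realisable-cong (inverse-cong {π = π} {ρ} π≗ρ) π⁻¹!

  RecolouredTo : {n : ℕ} → C → Colouring n C → Colouring n C → Set
  RecolouredTo j c d = ∀ x y → d x y ≡ j ⊎ d x y ≡ c x y

  RecolouredTo-trans : ∀ {n j} {c d e : Colouring n C} → RecolouredTo j c d → RecolouredTo j d e → RecolouredTo j c e
  RecolouredTo-trans c→d d→e x y with d→e x y
  ... | inj₁ e≡j = inj₁ e≡j
  ... | inj₂ e≡d = ⊎-map (trans e≡d) (trans e≡d) (c→d x y)

  module _ {k : ℕ} {orb : C → Fin k} (isOrb : IsOrbitLabelling (Commutator Γ) k orb) (j : C) where

    recolour-edge : ∀ {n} (c : Colouring n C) → Symmetric c → ∀ u w → u ≢ w → orb (c u w) ≡ orb j →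
                    ∃[ d ] (SwitchEq Γ c d × d u w ≡ j × RecolouredTo j c d)
    recolour-edge c c-sym u w u≢w same-orbit with proj₁ (proj₂ isOrb (c u w) j) same-orbit
    ... | π , cπ , π[cuw]≡j with proj₁ (commutatorSubgroup-realisable cπ) .realise c u w u≢w
    ... | d , c∼d , uw , wu , off = d , c∼d , trans uw π[cuw]≡j , recoloured
      where
      recoloured : RecolouredTo j c d
      recoloured x y with x ≟ u ×-dec y ≟ w | x ≟ w ×-dec y ≟ u
      ... | yes (refl , refl) | _                  = inj₁ (trans uw π[cuw]≡j)
      ... | no _              | yes (refl , refl)  = inj₁ (trans wu (trans (cong (app π) (c-sym w u)) π[cuw]≡j))
      ... | no ¬uw            | no ¬wu             = inj₂ (off x y ¬uw ¬wu)

    recolour-clique-edges : ∀ {n b} (h : Fin b → Fin n) → (∀ s t → h s ≡ h t → s ≡ t) →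
      (es : List (Fin b × Fin b)) (c : Colouring n C) → Symmetric c →
      (∀ {s t} → (s , t) ∈ es → s ≢ t → orb (c (h s) (h t)) ≡ orb j) →
      ∃[ d ] (SwitchEq Γ c d × RecolouredTo j c d × (∀ {s t} → (s , t) ∈ es → s ≢ t → d (h s) (h t) ≡ j))
    recolour-clique-edges h h-inj [] c _ _ = c , done , (λ _ _ → inj₂ refl) , λ ()
    recolour-clique-edges h h-inj ((s , t) ∷ es) c c-sym in-orbit
      with recolour-clique-edges h h-inj es c c-sym (in-orbit ∘ there)
    ... | d , c∼d , c→d , es-j with s ≟ t
    ...   | yes refl = d , c∼d , c→d , λ { (here refl) s≢s → ⊥-elim (s≢s refl) ; (there m) → es-j m }
    ...   | no s≢t
      with recolour-edge d (SwitchEq-symmetric c∼d c-sym) (h s) (h t) (s≢t ∘ h-inj s t) st-in-orbit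
      where
      st-in-orbit : orb (d (h s) (h t)) ≡ orb j
      st-in-orbit = [ cong orb , (λ d≡c → trans (cong orb d≡c) (in-orbit (here refl) s≢t)) ] (c→d (h s) (h t))
    ...     | e , d∼e , st-j , d→e = e , SwitchEq-trans c∼d d∼e , RecolouredTo-trans c→d d→e , all-j
      where
      all-j : ∀ {s′ t′} → (s′ , t′) ∈ ((s , t) ∷ es) → s′ ≢ t′ → e (h s′) (h t′) ≡ j
      all-j (here refl) _     = st-j
      all-j (there m) s′≢t′ = [ id , (λ e≡d → trans e≡d (es-j m s′≢t′)) ] (d→e _ _)

    orbitClique⇒monoClique : ∀ {n b} (c : Colouring n C) → Symmetric c →
      HasMonoClique (λ x y → orb (c x y)) b (orb j) → ∃[ d ] (SwitchEq Γ c d × HasMonoClique d b j)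
    orbitClique⇒monoClique {b = b} c c-sym (h , h-inj , h-orbit)
      with recolour-clique-edges h h-inj (cartesianProduct (allFin b) (allFin b)) c c-sym (λ {s} {t} _ → h-orbit s t)
    ... | d , c∼d , _ , all-j =
      d , c∼d , h , h-inj , λ s t s≢t → all-j (∈-cartesianProduct⁺ (∈-allFin s) (∈-allFin t)) s≢t

module _ {C C′ K : Set} (φ : C′ → K) (ψ : C → K) where

  Over : {M N : ℕ} → (Fin M → Fin N) → Colouring M C′ → Colouring N C → Set
  Over f d c = ∀ s t → s ≢ t → φ (d s t) ≡ ψ (c (f s) (f t))

  Covers : (Perm C′ → Set) → (Perm C → Set) → Set
  Covers Δ Γ = ∀ τ → Δ τ → ∃[ σ ] (Γ σ × (∀ x y → φ x ≡ ψ y → φ (app τ x) ≡ ψ (app σ y)))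

  module _ {M N : ℕ} {f : Fin M → Fin N} (f-inj : ∀ s t → f s ≡ f t → s ≡ t) where

    switch-over : ∀ {d c} v {τ σ} → (∀ x y → φ x ≡ ψ y → φ (app τ x) ≡ ψ (app σ y)) →
                  Over f d c → Over f (switch v (app τ) d) (switch (f v) (app σ) c)
    switch-over {d} {c} v {τ} {σ} covered over s t s≢t
      rewrite switch-when v (app τ) d s t | switch-when (f v) (app σ) c (f s) (f t)
      with incident? v s t | incident? (f v) (f s) (f t)
    ... | yes _  | yes _  = covered _ _ (over s t s≢t)
    ... | no _   | no _   = over s t s≢t
    ... | yes i  | no ¬i  = ⊥-elim (¬i (⊎-map (cong f) (cong f) i))
    ... | no ¬i  | yes i  = ⊥-elim (¬i (⊎-map (f-inj _ _) (f-inj _ _) i))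

    SwitchEq-lift : ∀ {Δ Γ} → Covers Δ Γ → ∀ {d d′} → SwitchEq Δ d d′ → ∀ c → Over f d c →
                    ∃[ c′ ] (SwitchEq Γ c c′ × Over f d′ c′)
    SwitchEq-lift _ done c over = c , done , over
    SwitchEq-lift covers (step v τ Δτ d∼d′) c over with covers τ Δτ
    ... | σ , Γσ , covered with SwitchEq-lift covers d∼d′ (switch (f v) (app σ) c) (switch-over v {τ} {σ} covered over)
    ...   | c′ , c∼c′ , over′ = c′ , step (f v) σ Γσ c∼c′ , over′

    Over-clique : ∀ {d c b x} → Over f d c → HasMonoClique d b x → HasMonoClique (λ u w → ψ (c u w)) b (φ x)
    Over-clique over (g , g-inj , g-mono) =
      f ∘ g , (λ s t → g-inj s t ∘ f-inj (g s) (g t)) ,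
      λ s t s≢t → trans (sym (over (g s) (g t) (s≢t ∘ g-inj s t))) (cong φ (g-mono s t s≢t))

restrict-covers : ∀ {m k q} {Γ : Perm (Fin m) → Set} {orb : Fin m → Fin k} {porb : Fin k → Fin q} ℓ →
                  Covers proj₁ orb (Restrict (Induced Γ orb) porb ℓ) Γ
restrict-covers ℓ τ′ (τ , (σ , Γσ , τ-induced) , τ′-restricts) =
  σ , Γσ , λ x y x≡orb-y → trans (τ′-restricts x) (trans (cong (app τ) x≡orb-y) (τ-induced y))

module _ {k q : ℕ} {porb : Fin k → Fin q} {ℓ : Fin q} {C : Set} (ψ : C → Fin k) {M N : ℕ}
         (c : Colouring N C) (f : Fin M → Fin N) (f-mono : ∀ s t → s ≢ t → porb (ψ (c (f s) (f t))) ≡ ℓ)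
         (p₀ : Part porb ℓ) where

  -- p₀ only fills the diagonal, whose colours are irrelevant.
  restrictColouring : Colouring M (Part porb ℓ)
  restrictColouring s t with s ≟ t
  ... | yes _   = p₀
  ... | no s≢t = ψ (c (f s) (f t)) , f-mono s t s≢t

  restrictColouring-symmetric : Symmetric c → Symmetric restrictColouring
  restrictColouring-symmetric c-sym s t with s ≟ t | t ≟ s
  ... | yes _    | yes _    = refl
  ... | yes refl | no s≢s   = ⊥-elim (s≢s refl)
  ... | no s≢s   | yes refl = ⊥-elim (s≢s refl)
  ... | no _     | no _     =
    Σ-≡,≡→≡ (cong ψ (c-sym (f s) (f t)) , Decidable⇒UIP.≡-irrelevant _≟_ _ _)

  restrictColouring-over : Over proj₁ ψ f restrictColouring c
  restrictColouring-over s t s≢t with s ≟ t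
  ... | yes s≡t = ⊥-elim (s≢t s≡t)
  ... | no _    = refl

theorem12 : (m : ℕ) (Γ : Perm (Fin m) → Set) → IsPermGroup Γ →
    (a : Fin m → ℕ) → (∀ i → 2 ≤ a i) →
    (k : ℕ) (orb : Fin m → Fin k) → IsOrbitLabelling (Commutator Γ) k orb →
    (n : Fin k → ℕ) →
    (∀ i → (∃[ j ] (orb j ≡ i × a j ≡ n i)) × (∀ j → orb j ≡ i → n i ≤ a j)) →
    (q : ℕ) (porb : Fin k → Fin q) → IsOrbitLabelling (Induced Γ orb) q porb →
    (ms : Fin q → ℕ) →
    (∀ j → IsLeast (SwitchArrow (Restrict (Induced Γ orb) porb j) (λ x → n (proj₁ x))) (ms j)) →
    (N : ℕ) → IsLeast (Arrow ms) N →
    SwitchArrow Γ a N × (∀ r → IsLeast (SwitchArrow Γ a) r → r ≤ N)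
theorem12 m Γ isGroup a _ k orb isOrb n n-attained q porb isPorb ms ms-least N N-least =
  arrow , λ r r-least → proj₂ r-least N arrow
  where
  open CommutatorSwitching isGroup

  arrow : SwitchArrow Γ a N
  arrow c c-sym
    with proj₁ N-least (λ x y → porb (orb (c x y))) (λ x y → cong (porb ∘ orb) (c-sym x y))
  ... | ℓ , f , f-inj , f-mono
    with proj₁ (ms-least ℓ) (restrictColouring orb c f f-mono (proj₁ isPorb ℓ))
                            (restrictColouring-symmetric orb c f f-mono (proj₁ isPorb ℓ) c-sym)
  ... | D′ , D∼D′ , x , D′-clique
    with SwitchEq-lift proj₁ orb f-inj (restrict-covers ℓ) D∼D′ c
                       (restrictColouring-over orb c f f-mono (proj₁ isPorb ℓ))
  ... | c′ , c∼c′ , over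
    with proj₁ (n-attained (proj₁ x))
  ... | j , orb-j , a-j
    with orbitClique⇒monoClique isOrb j c′ (SwitchEq-symmetric c∼c′ c-sym)
           (subst (HasMonoClique (λ u w → orb (c′ u w)) _) (sym orb-j) (Over-clique proj₁ orb f-inj {d = D′} {c = c′} over D′-clique))
  ... | d , c′∼d , d-clique =
    d , SwitchEq-trans c∼c′ c′∼d , j , subst (λ b → HasMonoClique d b j) (sym a-j) d-clique
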